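{- Let $k,l\ge1$ with $k\ne l$ and $1\le r\le(2k+1)(2l+1)$. Let $\begin{pmatrix}\lambda_1&\lambda_2&\lambda_3&\lambda_4\\ \delta_1&\delta_2&\delta_3&\delta_4\end{pmatrix}_c$ be the board partition of some board in $\mathcal{B}(2k+1,2l+1;r)$ satisfying: (i) $\lambda_1\ge\lambda_i$ for all $i>1$; (ii) if $\lambda_1=\lambda_3$ then $\lambda_2\ge\lambda_4$, if in addition $\lambda_2=\lambda_4$ then $\delta_1\ge\delta_3$, and if further $\delta_1=\delta_3$ then $\delta_2\ge\delta_4$; (iii) if $\lambda_1=\lambda_2$ then $\lambda_3\ge\lambda_4$, and if in addition $\lambda_3=\lambda_4$ then $\delta_2\ge\delta_4$; (iv) if $\lambda_1=\lambda_4$ then $\lambda_2\ge\lambda_3$, and if in addition $\lambda_2=\lambda_3$ then $\delta_1\ge\delta_3$. Let $K\le G=\{R_0,H,V,R_{180}\}$ be the subgroup of symmetries preserving the set of boards in $\mathcal{B}(2k+1,2l+1;r)$ with this board partition. Then: if $\lambda_1=\lambda_2=\lambda_3=\lambda_4$, $\delta_1=\delta_3$ and $\delta_2=\delta_4$, then $K=G$, $[G:K]=1$; if $\lambda_1=\lambda_3>\lambda_2=\lambda_4$, $\delta_1=\delta_3$ and $\delta_2=\delta_4$, then $K=\langle R_{180}\rangle$, $[G:K]=2$; if $\lambda_1=\lambda_2$, $\lambda_3=\lambda_4$, $\delta_2=\delta_4$, and (if $\lambda_2=\lambda_3$ then $\delta_1\ne\delta_3$), then $K=\langle V\rangle$,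 $[G:K]=2$; if $\lambda_1=\lambda_4$, $\lambda_2=\lambda_3$, $\delta_1=\delta_3$, and (if $\lambda_1=\lambda_2$ then $\delta_2\ne\delta_4$), then $K=\langle H\rangle$, $[G:K]=2$; in all other cases $K$ is trivial and $[G:K]=4$.
   Context: A $(2k+1)\times(2l+1)$ grid has cells $(i,j)$, $1\le i\le 2k+1$ (row from top), $1\le j\le 2l+1$ (column from left); $\mathcal{B}(2k+1,2l+1;r)$ is the set of all choices of exactly $r$ blocked cells. $G$ acts by the identity $R_0$, $H$ (reflection across the horizontal midline, $(i,j)\mapsto(2k+2-i,j)$), $V$ (reflection across the vertical midline, $(i,j)\mapsto(i,2l+2-j)$), and $R_{180}$ (rotation by 180 degrees). Regions: upper-left corner (rows $1..k$, columns $1..l$), top strip (rows $1..k$, column $l+1$), upper-right corner (rows $1..k$, columns $l+2..2l+1$), right strip (row $k+1$, columns $l+2..2l+1$), lower-right corner (rows $k+2..2k+1$, columns $l+2..2l+1$), bottom strip (rows $k+2..2k+1$, column $l+1$), lower-left corner (rows $k+2..2k+1$, columns $1..l$), left strip (row $k+1$, columns $1..l$), center $(k+1,l+1)$. The board partition lists the numbers of blocked cells: $\lambda_1,\dots,\lambda_4$ in the upper-left, upper-right, lower-right, lower-left corners; $\delta_1,\dots,\delta_4$ in the top, right, bottom, left strips; $c\in\{0,1\}$ in the center. A symmetry preserves a set of boards if it maps that set onto itself. -}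

module Defs where

open import Data.Nat using (ℕ; zero; suc; _+_; _*_; _≤ᵇ_; _≡ᵇ_)
open import Data.Bool using (Bool; true; false; _∧_; if_then_else_)
open import Data.Fin using (Fin; toℕ; opposite)
open import Data.List using (List; map; allFin)
open import Data.Nat.ListAction using (sum)
open import Data.Product using (_×_; Σ)
open import Relation.Binary.PropositionalEquality using (_≡_)
open import Data.Sum using (_⊎_)
open import Data.Unit using (⊤)
open import Data.Empty using (⊥)
open import Data.List using (length; filter)
open import Function.Bundles using (_⇔_)

-- A board on the (2k+1) × (2l+1) grid: row index (0-based) then column index.
-- The value true means the cell is blocked.
Board : ℕ → ℕ → Set
Board k l = Fin (2 * k + 1) → Fin (2 * l + 1) → Bool

-- Number of blocked cells of B among cells (i,j) (1-based coordinates) satisfying P.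
countIn : ∀ k l → Board k l → (ℕ → ℕ → Bool) → ℕ
countIn k l B P =
  sum (map (λ i → sum (map (λ j → if B i j ∧ P (suc (toℕ i)) (suc (toℕ j)) then 1 else 0)
                           (allFin (2 * l + 1))))
           (allFin (2 * k + 1)))

blocked : ∀ k l → Board k l → ℕ
blocked k l B = countIn k l B (λ _ _ → true)

InB : ∀ k l → ℕ → Board k l → Set
InB k l r B = blocked k l B ≡ r

between : ℕ → ℕ → ℕ → Bool
between a b x = (a ≤ᵇ x) ∧ (x ≤ᵇ b)

-- regions, in 1-based coordinates (i = row from top, j = column from left)
upperLeft upperRight lowerRight lowerLeft : ℕ → ℕ → ℕ → ℕ → Bool
upperLeft  k l i j = between 1 k i ∧ between 1 l j
upperRight k l i j = between 1 k i ∧ between (l + 2) (2 * l + 1) j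
lowerRight k l i j = between (k + 2) (2 * k + 1) i ∧ between (l + 2) (2 * l + 1) j
lowerLeft  k l i j = between (k + 2) (2 * k + 1) i ∧ between 1 l j

topStrip rightStrip bottomStrip leftStrip center : ℕ → ℕ → ℕ → ℕ → Bool
topStrip    k l i j = between 1 k i ∧ (j ≡ᵇ (l + 1))
rightStrip  k l i j = (i ≡ᵇ (k + 1)) ∧ between (l + 2) (2 * l + 1) j
bottomStrip k l i j = between (k + 2) (2 * k + 1) i ∧ (j ≡ᵇ (l + 1))
leftStrip   k l i j = (i ≡ᵇ (k + 1)) ∧ between 1 l j
center      k l i j = (i ≡ᵇ (k + 1)) ∧ (j ≡ᵇ (l + 1))

record Partition : Set where
  constructor mkPartition
  field
    lam₁ lam₂ lam₃ lam₄ : ℕ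
    del₁ del₂ del₃ del₄ : ℕ
    cen : ℕ

partitionOf : ∀ k l → Board k l → Partition
partitionOf k l B = mkPartition
  (countIn k l B (upperLeft k l)) (countIn k l B (upperRight k l))
  (countIn k l B (lowerRight k l)) (countIn k l B (lowerLeft k l))
  (countIn k l B (topStrip k l)) (countIn k l B (rightStrip k l))
  (countIn k l B (bottomStrip k l)) (countIn k l B (leftStrip k l))
  (countIn k l B (center k l))

BoardsWith : ∀ k l → ℕ → Partition → Board k l → Set
BoardsWith k l r p B = InB k l r B × partitionOf k l B ≡ p

data Sym : Set where
  R0 H V R180 : Sym

-- action on cells; `opposite` sends 0-based index a to (2k) - a,
-- i.e. 1-based row i to 2k+2-i.
actRow : ∀ k → Sym → Fin (2 * k + 1) → Fin (2 * k + 1)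
actRow k R0   i = i
actRow k H    i = opposite i
actRow k V    i = i
actRow k R180 i = opposite i

actCol : ∀ l → Sym → Fin (2 * l + 1) → Fin (2 * l + 1)
actCol l R0   j = j
actCol l H    j = j
actCol l V    j = opposite j
actCol l R180 j = opposite j

-- image of a board under g: the blocked cells of g·B are the images of the
-- blocked cells of B; since every g is an involution, (g·B)(c) = B(g c).
actBoard : ∀ k l → Sym → Board k l → Board k l
actBoard k l g B i j = B (actRow k g i) (actCol l g j)

BoardEq : ∀ k l → Board k l → Board k l → Set
BoardEq k l B B' = ∀ i j → B i j ≡ B' i j

Preserves : ∀ k l → Sym → (Board k l → Set) → Set
Preserves k l g S =
  ((B : Board k l) → S B → S (actBoard k l g B)) ×
  ((B : Board k l) → S B → Σ (Board k l) (λ B' → S B' × BoardEq k l (actBoard k l g B') B))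

⟨R180⟩ ⟨V⟩ ⟨H⟩ trivialSub wholeG : Sym → Set
⟨R180⟩ g = (g ≡ R0) ⊎ (g ≡ R180)
⟨V⟩ g = (g ≡ R0) ⊎ (g ≡ V)
⟨H⟩ g = (g ≡ R0) ⊎ (g ≡ H)
trivialSub g = g ≡ R0
wholeG _ = ⊤

KIs : ∀ k l → (Board k l → Set) → (Sym → Set) → Set
KIs k l S P = ∀ g → Preserves k l g S ⇔ P g


open import Data.Nat using (_≥_; _>_)
open import Relation.Nullary using (¬_)

module _ (p : Partition) where
  open Partition p

  condI condII condIII condIV : Set
  condI = (lam₁ ≥ lam₂) × (lam₁ ≥ lam₃) × (lam₁ ≥ lam₄)
  condII = lam₁ ≡ lam₃ →
             (lam₂ ≥ lam₄) ×
             (lam₂ ≡ lam₄ → (del₁ ≥ del₃) × (del₁ ≡ del₃ → del₂ ≥ del₄))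
  condIII = lam₁ ≡ lam₂ → (lam₃ ≥ lam₄) × (lam₃ ≡ lam₄ → del₂ ≥ del₄)
  condIV = lam₁ ≡ lam₄ → (lam₂ ≥ lam₃) × (lam₂ ≡ lam₃ → del₁ ≥ del₃)

  case1 case2 case3 case4 : Set
  case1 = (lam₁ ≡ lam₂) × (lam₂ ≡ lam₃) × (lam₃ ≡ lam₄) × (del₁ ≡ del₃) × (del₂ ≡ del₄)
  case2 = (lam₁ ≡ lam₃) × (lam₁ > lam₂) × (lam₂ ≡ lam₄) × (del₁ ≡ del₃) × (del₂ ≡ del₄)
  case3 = (lam₁ ≡ lam₂) × (lam₃ ≡ lam₄) × (del₂ ≡ del₄) × (lam₂ ≡ lam₃ → ¬ (del₁ ≡ del₃))
  case4 = (lam₁ ≡ lam₄) × (lam₂ ≡ lam₃) × (del₁ ≡ del₃) × (lam₁ ≡ lam₂ → ¬ (del₂ ≡ del₄))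

{-# OPTIONS --safe #-}

-- Every g ∈ G reflects the rows, the columns, or both.  Reflecting a line of
-- length 2k+1 swaps its k indices before the middle with the k after it and
-- fixes the middle, so g permutes the nine regions of the board; as g merely
-- permutes cells, the board partition of g·B is that of B with its entries
-- permuted accordingly, and g·B has as many blocked cells as B.  Hence g
-- preserves the (nonempty) set of boards with partition p exactly when p is
-- fixed by this permutation, i.e. when a few of the λᵢ and δᵢ coincide.  The
-- five cases then follow by propositional reasoning, with λ₁ ≥ λ₂ separating
-- the second case from the first.

module Submission where

open import Defs
open import Data.Nat using (ℕ; zero; suc; _+_; _*_; _∸_; _≤_; _<_; _≥_; _≤ᵇ_; _<ᵇ_; _≡ᵇ_)
open import Data.Nat.Properties
open import Data.Bool using (Bool; true; false; _∧_; if_then_else_)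
open import Data.Bool.Properties using (∧-identityʳ)
open import Data.Unit using (⊤; tt)
open import Data.Empty using (⊥-elim)
open import Data.Fin using (Fin; toℕ; opposite)
open import Data.Fin.Properties using (toℕ<n; opposite-prop; opposite-involutive)
open import Data.Fin.Permutation using (reverse)
open import Data.List using (map; allFin; tabulate)
open import Data.List.Properties using (map-tabulate; map-cong)
import Data.Nat.ListAction as List
open import Data.Product using (_×_; Σ; _,_; proj₂)
open import Data.Sum using (inj₁; inj₂)
open import Function using (_∘_; id)
open import Function.Bundles using (_⇔_; mk⇔)
open import Function.Construct.Composition using (_⇔-∘_)
open import Relation.Binary using (tri<; tri≈; tri>)
open import Relation.Binary.PropositionalEquality
open import Relation.Nullary using (¬_; yes; no)
open import Relation.Nullary.Decidable using (dec-true; dec-false)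
open import Algebra.Properties.CommutativeMonoid.Sum +-0-commutativeMonoid
  using (sum; sum-syntax; sum-permute; sum-cong-≗)

-- The indices before, at and after the middle line; a region of the board is
-- a pair (row band, column band).
data Band : Set where
  lo mid hi : Band

reflect : Band → Band
reflect lo  = hi
reflect mid = mid
reflect hi  = lo

reflectIf : Bool → Band → Band
reflectIf false a = a
reflectIf true  a = reflect a

_==_ : Band → Band → Bool
lo  == lo  = true
mid == mid = true
hi  == hi  = true
_   == _   = false

reflect-== : ∀ x a → (reflect x == a) ≡ (x == reflect a)
reflect-== lo  lo  = refl
reflect-== lo  mid = refl
reflect-== lo  hi  = refl
reflect-== mid lo  = refl
reflect-== mid mid = refl
reflect-== mid hi  = refl
reflect-== hi  lo  = refl
reflect-== hi  mid = refl
reflect-== hi  hi  = refl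

reflectIf-== : ∀ b x a → (reflectIf b x == a) ≡ (x == reflectIf b a)
reflectIf-== false x a = refl
reflectIf-== true  x a = reflect-== x a

bandOf : ℕ → ℕ → Band
bandOf k x with <-cmp x k
... | tri< _ _ _ = lo
... | tri≈ _ _ _ = mid
... | tri> _ _ _ = hi

middle-reflect : ∀ {k x y} → y + x ≡ k + k → x ≡ k → y ≡ k
middle-reflect {k} {y = y} e refl = +-cancelʳ-≡ k y k e

bandOf-reflect : ∀ k x y → y + x ≡ k + k → bandOf k y ≡ reflect (bandOf k x)
bandOf-reflect k x y e with <-cmp x k | <-cmp y k
... | tri< _ _ _   | tri> _ _ _   = refl
... | tri≈ _ _ _   | tri≈ _ _ _   = refl
... | tri> _ _ _   | tri< _ _ _   = refl
... | tri< x<k _ _ | tri< y<k _ _ = ⊥-elim (<-irrefl e (+-mono-< y<k x<k))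
... | tri< x<k _ _ | tri≈ _ y≡k _ = ⊥-elim (<-irrefl (middle-reflect (trans (+-comm x y) e) y≡k) x<k)
... | tri≈ _ x≡k _ | tri< y<k _ _ = ⊥-elim (<-irrefl (middle-reflect e x≡k) y<k)
... | tri≈ _ x≡k _ | tri> _ _ k<y = ⊥-elim (<-irrefl (sym (middle-reflect e x≡k)) k<y)
... | tri> _ _ k<x | tri≈ _ y≡k _ = ⊥-elim (<-irrefl (sym (middle-reflect (trans (+-comm x y) e) y≡k)) k<x)
... | tri> _ _ k<x | tri> _ _ k<y = ⊥-elim (<-irrefl (sym e) (+-mono-< k<y k<x))

oppositeIf : ∀ {n} → Bool → Fin n → Fin n
oppositeIf false i = i
oppositeIf true  i = opposite i

oppositeIf-involutive : ∀ {n} b (i : Fin n) → oppositeIf b (oppositeIf b i) ≡ i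
oppositeIf-involutive false i = refl
oppositeIf-involutive true  i = opposite-involutive i

toℕ-opposite+toℕ : ∀ k (i : Fin (2 * k + 1)) → toℕ (opposite i) + toℕ i ≡ k + k
toℕ-opposite+toℕ k i = suc-injective (begin
  suc (toℕ (opposite i) + toℕ i)         ≡⟨ +-suc (toℕ (opposite i)) (toℕ i) ⟨
  toℕ (opposite i) + suc (toℕ i)         ≡⟨ cong (_+ suc (toℕ i)) (opposite-prop i) ⟩
  2 * k + 1 ∸ suc (toℕ i) + suc (toℕ i)  ≡⟨ m∸n+n≡m (toℕ<n i) ⟩
  2 * k + 1                              ≡⟨ +-comm (2 * k) 1 ⟩
  suc (k + (k + 0))                      ≡⟨ cong (λ m → suc (k + m)) (+-identityʳ k) ⟩
  suc (k + k)                            ∎)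
  where open ≡-Reasoning

band : ∀ k → Fin (2 * k + 1) → Band
band k i = bandOf k (toℕ i)

band-oppositeIf : ∀ k b (i : Fin (2 * k + 1)) → band k (oppositeIf b i) ≡ reflectIf b (band k i)
band-oppositeIf k false i = refl
band-oppositeIf k true  i = bandOf-reflect k (toℕ i) (toℕ (opposite i)) (toℕ-opposite+toℕ k i)

coord : ∀ {n} → Fin n → ℕ
coord i = suc (toℕ i)

inBand : Band → ℕ → ℕ → Bool
inBand lo  k x = between 1 k x
inBand mid k x = x ≡ᵇ (k + 1)
inBand hi  k x = between (k + 2) (2 * k + 1) x

inBand₀ : Band → ℕ → ℕ → Bool
inBand₀ lo  k x = x <ᵇ k
inBand₀ mid k x = x ≡ᵇ k
inBand₀ hi  k x = k <ᵇ x

inBand-suc : ∀ a k x → x < 2 * k + 1 → inBand a k (suc x) ≡ inBand₀ a k x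
inBand-suc lo  k x _       = refl
inBand-suc mid k x _       = cong (suc x ≡ᵇ_) (+-comm k 1)
inBand-suc hi  k x x<2k+1 = begin
  (k + 2 ≤ᵇ suc x) ∧ (suc x ≤ᵇ 2 * k + 1)
    ≡⟨ cong₂ _∧_ (cong (_≤ᵇ suc x) (+-comm k 2)) (dec-true (suc x ≤? 2 * k + 1) x<2k+1) ⟩
  (k <ᵇ x) ∧ true
    ≡⟨ ∧-identityʳ (k <ᵇ x) ⟩
  k <ᵇ x ∎
  where open ≡-Reasoning

inBand₀-bandOf : ∀ a k x → inBand₀ a k x ≡ (bandOf k x == a)
inBand₀-bandOf a k x with <-cmp x k
inBand₀-bandOf lo  k x | tri< x<k _   _   = dec-true (x <? k) x<k
inBand₀-bandOf mid k x | tri< _   x≢k _   = dec-false (x ≟ k) x≢k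
inBand₀-bandOf hi  k x | tri< _   _   x≯k = dec-false (k <? x) x≯k
inBand₀-bandOf lo  k x | tri≈ x≮k _   _   = dec-false (x <? k) x≮k
inBand₀-bandOf mid k x | tri≈ _   x≡k _   = dec-true (x ≟ k) x≡k
inBand₀-bandOf hi  k x | tri≈ _   _   x≯k = dec-false (k <? x) x≯k
inBand₀-bandOf lo  k x | tri> x≮k _   _   = dec-false (x <? k) x≮k
inBand₀-bandOf mid k x | tri> _   x≢k _   = dec-false (x ≟ k) x≢k
inBand₀-bandOf hi  k x | tri> _   _   k<x = dec-true (k <? x) k<x

region : Band → Band → ℕ → ℕ → ℕ → ℕ → Bool
region a b k l x y = inBand a k x ∧ inBand b l y

inBand-band : ∀ a k (i : Fin (2 * k + 1)) → inBand a k (coord i) ≡ (band k i == a)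
inBand-band a k i = trans (inBand-suc a k (toℕ i) (toℕ<n i)) (inBand₀-bandOf a k (toℕ i))

inBand-oppositeIf : ∀ a k b (i : Fin (2 * k + 1)) →
  inBand a k (coord (oppositeIf b i)) ≡ inBand (reflectIf b a) k (coord i)
inBand-oppositeIf a k b i = begin
  inBand a k (coord (oppositeIf b i))  ≡⟨ inBand-band a k (oppositeIf b i) ⟩
  (band k (oppositeIf b i) == a)       ≡⟨ cong (_== a) (band-oppositeIf k b i) ⟩
  (reflectIf b (band k i) == a)        ≡⟨ reflectIf-== b (band k i) a ⟩
  (band k i == reflectIf b a)          ≡⟨ inBand-band (reflectIf b a) k i ⟨
  inBand (reflectIf b a) k (coord i)   ∎
  where open ≡-Reasoning

region-oppositeIf : ∀ a b k l β γ (i : Fin (2 * k + 1)) (j : Fin (2 * l + 1)) →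
  region a b k l (coord (oppositeIf β i)) (coord (oppositeIf γ j))
    ≡ region (reflectIf β a) (reflectIf γ b) k l (coord i) (coord j)
region-oppositeIf a b k l β γ i j = cong₂ _∧_ (inBand-oppositeIf a k β i) (inBand-oppositeIf b l γ j)

sum-tabulate : ∀ n (f : Fin n → ℕ) → List.sum (tabulate f) ≡ sum f
sum-tabulate zero    f = refl
sum-tabulate (suc n) f = cong (f Fin.zero +_) (sum-tabulate n (f ∘ Fin.suc))

sum-map-allFin : ∀ n (f : Fin n → ℕ) → List.sum (map f (allFin n)) ≡ sum f
sum-map-allFin n f = trans (cong List.sum (map-tabulate id f)) (sum-tabulate n f)

sum-oppositeIf : ∀ {n} b (f : Fin n → ℕ) → sum f ≡ sum (f ∘ oppositeIf b)
sum-oppositeIf false f = refl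
sum-oppositeIf true  f = sum-permute f reverse

cellCount : ∀ k l → Board k l → (ℕ → ℕ → Bool) → Fin (2 * k + 1) → Fin (2 * l + 1) → ℕ
cellCount k l B P i j = if B i j ∧ P (coord i) (coord j) then 1 else 0

countIn-sum : ∀ k l B P → countIn k l B P ≡ ∑[ i < 2 * k + 1 ] ∑[ j < 2 * l + 1 ] cellCount k l B P i j
countIn-sum k l B P = begin
  List.sum (map (λ i → List.sum (map (cellCount k l B P i) (allFin _))) (allFin _))
    ≡⟨ cong List.sum (map-cong (λ i → sum-map-allFin _ (cellCount k l B P i)) (allFin _)) ⟩
  List.sum (map (λ i → sum (cellCount k l B P i)) (allFin _))
    ≡⟨ sum-map-allFin _ (λ i → sum (cellCount k l B P i)) ⟩
  sum (λ i → sum (cellCount k l B P i)) ∎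
  where open ≡-Reasoning

mirrorBoard : ∀ k l → Bool → Bool → Board k l → Board k l
mirrorBoard k l β γ B i j = B (oppositeIf β i) (oppositeIf γ j)

mirrorBoard-involutive : ∀ k l β γ (B : Board k l) → BoardEq k l (mirrorBoard k l β γ (mirrorBoard k l β γ B)) B
mirrorBoard-involutive k l β γ B i j = cong₂ B (oppositeIf-involutive β i) (oppositeIf-involutive γ j)

countIn-mirrorBoard : ∀ k l β γ B (P Q : ℕ → ℕ → Bool) →
  (∀ i j → P (coord (oppositeIf β i)) (coord (oppositeIf γ j)) ≡ Q (coord i) (coord j)) →
  countIn k l (mirrorBoard k l β γ B) P ≡ countIn k l B Q
countIn-mirrorBoard k l β γ B P Q P≡Q = begin
  countIn k l B′ P
    ≡⟨ countIn-sum k l B′ P ⟩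
  sum (λ i → sum (cellCount k l B′ P i))
    ≡⟨ sum-oppositeIf β (λ i → sum (cellCount k l B′ P i)) ⟩
  sum (λ i → sum (cellCount k l B′ P (σ i)))
    ≡⟨ sum-cong-≗ (λ i → sum-oppositeIf γ (cellCount k l B′ P (σ i))) ⟩
  sum (λ i → sum (λ j → cellCount k l B′ P (σ i) (τ j)))
    ≡⟨ sum-cong-≗ (λ i → sum-cong-≗ (cellCount-mirrored i)) ⟩
  sum (λ i → sum (cellCount k l B Q i))
    ≡⟨ countIn-sum k l B Q ⟨
  countIn k l B Q ∎
  where
  open ≡-Reasoning
  B′ : Board k l
  B′ = mirrorBoard k l β γ B
  σ : Fin (2 * k + 1) → Fin (2 * k + 1)
  σ = oppositeIf β
  τ : Fin (2 * l + 1) → Fin (2 * l + 1)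
  τ = oppositeIf γ
  cellCount-mirrored : ∀ i j → cellCount k l B′ P (σ i) (τ j) ≡ cellCount k l B Q i j
  cellCount-mirrored i j = cong (λ b → if b then 1 else 0)
    (cong₂ _∧_ (mirrorBoard-involutive k l β γ B i j) (P≡Q i j))

flipsRows flipsCols : Sym → Bool
flipsRows R0   = false
flipsRows H    = true
flipsRows V    = false
flipsRows R180 = true
flipsCols R0   = false
flipsCols H    = false
flipsCols V    = true
flipsCols R180 = true

actBoard≡mirrorBoard : ∀ k l g (B : Board k l) → actBoard k l g B ≡ mirrorBoard k l (flipsRows g) (flipsCols g) B
actBoard≡mirrorBoard k l R0   B = refl
actBoard≡mirrorBoard k l H    B = refl
actBoard≡mirrorBoard k l V    B = refl
actBoard≡mirrorBoard k l R180 B = refl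

actBoard-involutive : ∀ k l g (B : Board k l) → BoardEq k l (actBoard k l g (actBoard k l g B)) B
actBoard-involutive k l R0   = mirrorBoard-involutive k l false false
actBoard-involutive k l H    = mirrorBoard-involutive k l true  false
actBoard-involutive k l V    = mirrorBoard-involutive k l false true
actBoard-involutive k l R180 = mirrorBoard-involutive k l true  true

tabulatePartition : (Band → Band → ℕ) → Partition
tabulatePartition n =
  mkPartition (n lo lo) (n lo hi) (n hi hi) (n hi lo) (n lo mid) (n mid hi) (n hi mid) (n mid lo) (n mid mid)

entry : Partition → Band → Band → ℕ
entry p lo  lo  = Partition.lam₁ p
entry p lo  hi  = Partition.lam₂ p
entry p hi  hi  = Partition.lam₃ p
entry p hi  lo  = Partition.lam₄ p
entry p lo  mid = Partition.del₁ p
entry p mid hi  = Partition.del₂ p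
entry p hi  mid = Partition.del₃ p
entry p mid lo  = Partition.del₄ p
entry p mid mid = Partition.cen p

entry-tabulatePartition : ∀ n a b → entry (tabulatePartition n) a b ≡ n a b
entry-tabulatePartition n lo  lo  = refl
entry-tabulatePartition n lo  mid = refl
entry-tabulatePartition n lo  hi  = refl
entry-tabulatePartition n mid lo  = refl
entry-tabulatePartition n mid mid = refl
entry-tabulatePartition n mid hi  = refl
entry-tabulatePartition n hi  lo  = refl
entry-tabulatePartition n hi  mid = refl
entry-tabulatePartition n hi  hi  = refl

mkPartition-cong : ∀ {λ₁ λ₂ λ₃ λ₄ δ₁ δ₂ δ₃ δ₄ c λ₁′ λ₂′ λ₃′ λ₄′ δ₁′ δ₂′ δ₃′ δ₄′ c′} →
  λ₁ ≡ λ₁′ → λ₂ ≡ λ₂′ → λ₃ ≡ λ₃′ → λ₄ ≡ λ₄′ → δ₁ ≡ δ₁′ → δ₂ ≡ δ₂′ → δ₃ ≡ δ₃′ → δ₄ ≡ δ₄′ → c ≡ c′ →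
  mkPartition λ₁ λ₂ λ₃ λ₄ δ₁ δ₂ δ₃ δ₄ c ≡ mkPartition λ₁′ λ₂′ λ₃′ λ₄′ δ₁′ δ₂′ δ₃′ δ₄′ c′
mkPartition-cong refl refl refl refl refl refl refl refl refl = refl

tabulatePartition-cong : ∀ {m n} → (∀ a b → m a b ≡ n a b) → tabulatePartition m ≡ tabulatePartition n
tabulatePartition-cong m≡n = mkPartition-cong
  (m≡n lo lo) (m≡n lo hi) (m≡n hi hi) (m≡n hi lo) (m≡n lo mid) (m≡n mid hi) (m≡n hi mid) (m≡n mid lo) (m≡n mid mid)

act : Sym → Partition → Partition
act g p = tabulatePartition (λ a b → entry p (reflectIf (flipsRows g) a) (reflectIf (flipsCols g) b))

-- Each region predicate of Defs is definitionally region a b k l for its pair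
-- of bands, so partitionOf k l B unfolds to
-- tabulatePartition (λ a b → countIn k l B (region a b k l)).
partitionOf-actBoard : ∀ k l g B → partitionOf k l (actBoard k l g B) ≡ act g (partitionOf k l B)
partitionOf-actBoard k l g B = begin
  partitionOf k l (actBoard k l g B)
    ≡⟨ cong (partitionOf k l) (actBoard≡mirrorBoard k l g B) ⟩
  tabulatePartition (λ a b → countIn k l (mirrorBoard k l β γ B) (region a b k l))
    ≡⟨ tabulatePartition-cong (λ a b → countIn-mirrorBoard k l β γ B
         (region a b k l) (region (reflectIf β a) (reflectIf γ b) k l) (region-oppositeIf a b k l β γ)) ⟩
  tabulatePartition (λ a b → count (reflectIf β a) (reflectIf γ b))
    ≡⟨ tabulatePartition-cong (λ a b → entry-tabulatePartition count (reflectIf β a) (reflectIf γ b)) ⟨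
  act g (partitionOf k l B) ∎
  where
  open ≡-Reasoning
  β γ : Bool
  β = flipsRows g
  γ = flipsCols g
  count : Band → Band → ℕ
  count a b = countIn k l B (region a b k l)

blocked-actBoard : ∀ k l g B → blocked k l (actBoard k l g B) ≡ blocked k l B
blocked-actBoard k l g B = begin
  blocked k l (actBoard k l g B)
    ≡⟨ cong (blocked k l) (actBoard≡mirrorBoard k l g B) ⟩
  blocked k l (mirrorBoard k l (flipsRows g) (flipsCols g) B)
    ≡⟨ countIn-mirrorBoard k l (flipsRows g) (flipsCols g) B (λ _ _ → true) (λ _ _ → true) (λ _ _ → refl) ⟩
  blocked k l B ∎
  where open ≡-Reasoning

preserves⇔act-fixes : ∀ k l r p g → Σ (Board k l) (BoardsWith k l r p) →
  Preserves k l g (BoardsWith k l r p) ⇔ (act g p ≡ p)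
preserves⇔act-fixes k l r p g (B₀ , B₀∈S) = mk⇔ to from
  where
  to : Preserves k l g (BoardsWith k l r p) → act g p ≡ p
  to (into , _) = begin
    act g p                              ≡⟨ cong (act g) (proj₂ B₀∈S) ⟨
    act g (partitionOf k l B₀)           ≡⟨ partitionOf-actBoard k l g B₀ ⟨
    partitionOf k l (actBoard k l g B₀)  ≡⟨ proj₂ (into B₀ B₀∈S) ⟩
    p                                    ∎
    where open ≡-Reasoning
  maps-into : act g p ≡ p → ∀ B → BoardsWith k l r p B → BoardsWith k l r p (actBoard k l g B)
  maps-into fixes B (B-size , B-partition) =
    trans (blocked-actBoard k l g B) B-size ,
    trans (partitionOf-actBoard k l g B) (trans (cong (act g) B-partition) fixes)
  from : act g p ≡ p → Preserves k l g (BoardsWith k l r p)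
  from fixes =
    maps-into fixes , λ B B∈S → actBoard k l g B , maps-into fixes B B∈S , actBoard-involutive k l g B

Fixes : Sym → Partition → Set
Fixes R0   p = ⊤
Fixes H    (mkPartition λ₁ λ₂ λ₃ λ₄ δ₁ δ₂ δ₃ δ₄ c) = (λ₁ ≡ λ₄) × (λ₂ ≡ λ₃) × (δ₁ ≡ δ₃)
Fixes V    (mkPartition λ₁ λ₂ λ₃ λ₄ δ₁ δ₂ δ₃ δ₄ c) = (λ₁ ≡ λ₂) × (λ₃ ≡ λ₄) × (δ₂ ≡ δ₄)
Fixes R180 (mkPartition λ₁ λ₂ λ₃ λ₄ δ₁ δ₂ δ₃ δ₄ c) = (λ₁ ≡ λ₃) × (λ₂ ≡ λ₄) × (δ₁ ≡ δ₃) × (δ₂ ≡ δ₄)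

act-fixes⇔Fixes : ∀ g p → (act g p ≡ p) ⇔ Fixes g p
act-fixes⇔Fixes R0   p = mk⇔ (λ _ → tt) (λ _ → refl)
act-fixes⇔Fixes H    (mkPartition λ₁ λ₂ λ₃ λ₄ δ₁ δ₂ δ₃ δ₄ c) =
  mk⇔ (λ { refl → refl , refl , refl }) (λ { (refl , refl , refl) → refl })
act-fixes⇔Fixes V    (mkPartition λ₁ λ₂ λ₃ λ₄ δ₁ δ₂ δ₃ δ₄ c) =
  mk⇔ (λ { refl → refl , refl , refl }) (λ { (refl , refl , refl) → refl })
act-fixes⇔Fixes R180 (mkPartition λ₁ λ₂ λ₃ λ₄ δ₁ δ₂ δ₃ δ₄ c) =
  mk⇔ (λ { refl → refl , refl , refl , refl }) (λ { (refl , refl , refl , refl) → refl })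

Stabiliser : Partition → (Sym → Set) → Set
Stabiliser p P = ∀ g → Fixes g p ⇔ P g

KIs-stabiliser : ∀ k l r p {P} → Σ (Board k l) (BoardsWith k l r p) →
  Stabiliser p P → KIs k l (BoardsWith k l r p) P
KIs-stabiliser k l r p nonempty stab g =
  stab g ⇔-∘ (act-fixes⇔Fixes g p ⇔-∘ preserves⇔act-fixes k l r p g nonempty)

stabiliser-case1 : ∀ p → case1 p → Stabiliser p wholeG
stabiliser-case1 p (refl , refl , refl , refl , refl) R0   = mk⇔ (λ _ → tt) (λ _ → tt)
stabiliser-case1 p (refl , refl , refl , refl , refl) H    = mk⇔ (λ _ → tt) (λ _ → refl , refl , refl)
stabiliser-case1 p (refl , refl , refl , refl , refl) V    = mk⇔ (λ _ → tt) (λ _ → refl , refl , refl)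
stabiliser-case1 p (refl , refl , refl , refl , refl) R180 =
  mk⇔ (λ _ → tt) (λ _ → refl , refl , refl , refl)

stabiliser-case2 : ∀ p → case2 p → Stabiliser p ⟨R180⟩
stabiliser-case2 p (refl , _ , refl , refl , refl) R0   = mk⇔ (λ _ → inj₁ refl) (λ _ → tt)
stabiliser-case2 p (refl , λ₁>λ₂ , refl , refl , refl) H    =
  mk⇔ (λ (λ₁≡λ₂ , _) → ⊥-elim (>⇒≢ λ₁>λ₂ λ₁≡λ₂))
      λ { (inj₁ ()) ; (inj₂ ()) }
stabiliser-case2 p (refl , λ₁>λ₂ , refl , refl , refl) V    =
  mk⇔ (λ (λ₁≡λ₂ , _) → ⊥-elim (>⇒≢ λ₁>λ₂ λ₁≡λ₂))
      λ { (inj₁ ()) ; (inj₂ ()) }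
stabiliser-case2 p (refl , _ , refl , refl , refl) R180 =
  mk⇔ (λ _ → inj₂ refl) (λ _ → refl , refl , refl , refl)

stabiliser-case3 : ∀ p → case3 p → Stabiliser p ⟨V⟩
stabiliser-case3 p (refl , refl , refl , _)  R0   = mk⇔ (λ _ → inj₁ refl) (λ _ → tt)
stabiliser-case3 p (refl , refl , refl , ¬H) H    =
  mk⇔ (λ (_ , λ₂≡λ₃ , δ₁≡δ₃) → ⊥-elim (¬H λ₂≡λ₃ δ₁≡δ₃))
      λ { (inj₁ ()) ; (inj₂ ()) }
stabiliser-case3 p (refl , refl , refl , _)  V    = mk⇔ (λ _ → inj₂ refl) (λ _ → refl , refl , refl)
stabiliser-case3 p (refl , refl , refl , ¬H) R180 =
  mk⇔ (λ (λ₂≡λ₃ , _ , δ₁≡δ₃ , _) → ⊥-elim (¬H λ₂≡λ₃ δ₁≡δ₃))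
      λ { (inj₁ ()) ; (inj₂ ()) }

stabiliser-case4 : ∀ p → case4 p → Stabiliser p ⟨H⟩
stabiliser-case4 p (refl , refl , refl , _)  R0   = mk⇔ (λ _ → inj₁ refl) (λ _ → tt)
stabiliser-case4 p (refl , refl , refl , _)  H    = mk⇔ (λ _ → inj₂ refl) (λ _ → refl , refl , refl)
stabiliser-case4 p (refl , refl , refl , ¬V) V    =
  mk⇔ (λ (λ₁≡λ₂ , _ , δ₂≡δ₄) → ⊥-elim (¬V λ₁≡λ₂ δ₂≡δ₄))
      λ { (inj₁ ()) ; (inj₂ ()) }
stabiliser-case4 p (refl , refl , refl , ¬V) R180 =
  mk⇔ (λ (λ₁≡λ₂ , _ , _ , δ₂≡δ₄) → ⊥-elim (¬V λ₁≡λ₂ δ₂≡δ₄))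
      λ { (inj₁ ()) ; (inj₂ ()) }

stabiliser-trivial : ∀ p → Partition.lam₁ p ≥ Partition.lam₂ p →
  ¬ case1 p → ¬ case2 p → ¬ case3 p → ¬ case4 p → Stabiliser p trivialSub
stabiliser-trivial p _ _ _ _ _ R0 = mk⇔ (λ _ → refl) (λ _ → tt)
stabiliser-trivial p _ ¬c1 _ _ ¬c4 H = mk⇔ fixes-absurd λ ()
  where
  fixes-absurd : Fixes H p → H ≡ R0
  fixes-absurd (refl , refl , refl) =
    ⊥-elim (¬c4 (refl , refl , refl , λ λ₁≡λ₂ δ₂≡δ₄ → ¬c1 (λ₁≡λ₂ , refl , sym λ₁≡λ₂ , refl , δ₂≡δ₄)))
stabiliser-trivial p _ ¬c1 _ ¬c3 _ V = mk⇔ fixes-absurd λ ()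
  where
  fixes-absurd : Fixes V p → V ≡ R0
  fixes-absurd (refl , refl , refl) =
    ⊥-elim (¬c3 (refl , refl , refl , λ λ₂≡λ₃ δ₁≡δ₃ → ¬c1 (refl , λ₂≡λ₃ , refl , δ₁≡δ₃ , refl)))
stabiliser-trivial p λ₁≥λ₂ ¬c1 ¬c2 _ _ R180 = mk⇔ fixes-absurd λ ()
  where
  fixes-absurd : Fixes R180 p → R180 ≡ R0
  fixes-absurd (refl , refl , refl , refl) with Partition.lam₁ p ≟ Partition.lam₂ p
  ... | yes λ₁≡λ₂ = ⊥-elim (¬c1 (λ₁≡λ₂ , sym λ₁≡λ₂ , λ₁≡λ₂ , refl , refl))
  ... | no  λ₁≢λ₂ = ⊥-elim (¬c2 (refl , ≤∧≢⇒< λ₁≥λ₂ (≢-sym λ₁≢λ₂) , refl , refl , refl))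

corollary4p8 : (k l r : ℕ) → 1 ≤ k → 1 ≤ l → ¬ (k ≡ l) →
    1 ≤ r → r ≤ (2 * k + 1) * (2 * l + 1) →
    (p : Partition) →
    Σ (Board k l) (λ B → InB k l r B × partitionOf k l B ≡ p) →
    condI p → condII p → condIII p → condIV p →
    (case1 p → KIs k l (BoardsWith k l r p) wholeG) ×
    (case2 p → KIs k l (BoardsWith k l r p) ⟨R180⟩) ×
    (case3 p → KIs k l (BoardsWith k l r p) ⟨V⟩) ×
    (case4 p → KIs k l (BoardsWith k l r p) ⟨H⟩) ×
    (¬ case1 p → ¬ case2 p → ¬ case3 p → ¬ case4 p →
      KIs k l (BoardsWith k l r p) trivialSub)
corollary4p8 k l r _ _ _ _ _ p nonempty (λ₁≥λ₂ , _) _ _ _ =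
    K ∘ stabiliser-case1 p
  , K ∘ stabiliser-case2 p
  , K ∘ stabiliser-case3 p
  , K ∘ stabiliser-case4 p
  , λ ¬c1 ¬c2 ¬c3 ¬c4 → K (stabiliser-trivial p λ₁≥λ₂ ¬c1 ¬c2 ¬c3 ¬c4)
  where
  K : ∀ {P} → Stabiliser p P → KIs k l (BoardsWith k l r p) P
  K = KIs-stabiliser k l r p nonempty
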